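{- Let $f=(a,b,c,d)$ be a reduced binary cubic form over $\mathbb{F}_q[t]$ of discriminant $D$ with imaginary or unusual Hessian $(P,Q,R)$. Then $|a|\le|D|^{1/4}$, $|b|\le|D|^{1/4}$, $|bc|\le|D|^{1/2}$ and $|ad|\le|D|^{1/2}$.
   Context: Let $q$ be a power of a prime $p\ge5$. For nonzero $H\in\mathbb{F}_q[t]$ put $|H|=q^{\deg H}$, $|0|=0$, and let $\mathrm{sgn}(H)$ be the leading coefficient. Fix a primitive root $h$ of $\mathbb{F}_q^*$ and $S=\{h^i:0\le i\le (q-3)/2\}$. A binary cubic form $f=(a,b,c,d)$ is $ax^3+bx^2y+cxy^2+dy^3$ with $a,b,c,d\in\mathbb{F}_q[t]$, discriminant $D=18abcd+b^2c^2-4ac^3-4b^3d-27a^2d^2$; forms are assumed primitive, irreducible, with nonzero discriminant. Its Hessian is $H_f=(P,Q,R)$ with $P=b^2-3ac$, $Q=bc-9ad$, $R=c^2-3bd$, of discriminant $Q^2-4PR=-3D$. The Hessian is imaginary if $\deg(-3D)$ is odd and unusual if $\deg(-3D)$ is even and $\mathrm{sgn}(-3D)$ is a non-square in $\mathbb{F}_q^*$; it is assumed that $\mathrm{sgn}(-3D)\in\{1,h\}$. Equivalence of forms: $g(x,y)=f(\alpha x+\beta y,\gamma x+\delta y)$ with $\alpha,\beta,\gamma,\delta\in\mathbb{F}_q[t]$, $\alpha\delta-\beta\gamma\in\mathbb{F}_q^*$. An imaginary or unusual quadratic form $(A,B,C)$ is partially reduced if $|B|<|A|\le|C|$; if $|A|<|C|$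 then $\mathrm{sgn}(A)\in\{1,h\}$, and if $|A|=|C|$ then $\mathrm{sgn}(A)=1$; $B\ne0$ implies $\mathrm{sgn}(B)\in S$. It is reduced if partially reduced and either $|A|<|C|$ or it is lexicographically smallest among the partially reduced forms in its equivalence class. A cubic form is reduced if $H_f$ is reduced, $\mathrm{sgn}(a)\in S$, if $Q=0$ then $\mathrm{sgn}(d)\in S$, and, when $H_f$ is unusual, $f$ is lexicographically smallest among all equivalent cubic forms with the same reduced Hessian satisfying the previous conditions. -}

module Defs where

open import Level using (0ℓ)
open import Data.Nat using (ℕ; zero; suc; _∸_; _^_; _/_; _≤_; _<_)
open import Data.List using (List; []; _∷_; length; map)
open import Data.List.Relation.Unary.Unique.Propositional using (Unique)
open import Data.List.Membership.Propositional using (_∈_)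
open import Data.List.Relation.Binary.Pointwise using (Pointwise)
open import Data.Product using (Σ; ∃; _×_; _,_)
open import Data.Sum using (_⊎_)
open import Data.Empty using (⊥)
open import Relation.Nullary using (¬_; yes; no)
open import Relation.Binary using (Rel; DecidableEquality)
open import Relation.Binary.PropositionalEquality using (_≡_)
open import Algebra.Structures using (IsCommutativeRing)

record FiniteField : Set₁ where
  infixl 7 _*_
  infixl 6 _+_
  field
    Carrier           : Set
    _+_ _*_           : Carrier → Carrier → Carrier
    -_                : Carrier → Carrier
    0# 1#             : Carrier
    isCommutativeRing : IsCommutativeRing _≡_ _+_ _*_ -_ 0# 1#
    0≢1               : ¬ (0# ≡ 1#)
    inverse           : ∀ x → ¬ (x ≡ 0#) → ∃ λ y → x * y ≡ 1#
    _≟_               : DecidableEquality Carrier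
    elements          : List Carrier
    elements-unique   : Unique elements
    elements-complete : ∀ x → x ∈ elements

  size : ℕ
  size = length elements

  fromℕ : ℕ → Carrier
  fromℕ zero    = 0#
  fromℕ (suc n) = 1# + fromℕ n

  _^F_ : Carrier → ℕ → Carrier
  x ^F zero  = 1#
  x ^F suc n = x * (x ^F n)

  IsSquare : Carrier → Set
  IsSquare x = ∃ λ y → y * y ≡ x

  IsPrimitiveRoot : Carrier → Set
  IsPrimitiveRoot h = ∀ x → ¬ (x ≡ 0#) → ∃ λ i → x ≡ h ^F i

-- Polynomials F[t] as coefficient lists (index i = coefficient of t^i),
-- possibly with trailing zeros; equality is equality after normalisation.

module Poly (F : FiniteField) where
  open FiniteField F

  P : Set
  P = List Carrier

  private
    cons′ : Carrier → P → P
    cons′ a [] with a ≟ 0#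
    ... | yes _ = []
    ... | no  _ = a ∷ []
    cons′ a (b ∷ r) = a ∷ b ∷ r

  norm : P → P
  norm []      = []
  norm (a ∷ p) = cons′ a (norm p)

  infix 4 _≈P_
  _≈P_ : P → P → Set
  p ≈P r = norm p ≡ norm r

  0P : P
  0P = []

  const : Carrier → P
  const c = c ∷ []

  infixl 6 _+P_ _-P_
  infixl 7 _*P_
  _+P_ : P → P → P
  []      +P r       = r
  (a ∷ p) +P []      = a ∷ p
  (a ∷ p) +P (b ∷ r) = (a + b) ∷ (p +P r)

  -P_ : P → P
  -P p = map -_ p

  _-P_ : P → P → P
  p -P r = p +P (-P r)

  _*P_ : P → P → P
  []      *P r = []
  (a ∷ p) *P r = map (a *_) r +P (0# ∷ (p *P r))

  natP : ℕ → P
  natP n = const (fromℕ n)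

  private
    lastOr : Carrier → List Carrier → Carrier
    lastOr d []       = d
    lastOr d (x ∷ xs) = lastOr x xs

    absN : P → ℕ
    absN []      = 0
    absN (_ ∷ r) = size ^ length r

  -- sgn H = leading coefficient (0 for H = 0)
  sgn : P → Carrier
  sgn p = lastOr 0# (norm p)

  -- deg H (with deg 0 = 0, never used for H = 0 below)
  deg : P → ℕ
  deg p = length (norm p) ∸ 1

  -- |H| = q^deg H, |0| = 0
  ∣_∣P : P → ℕ
  ∣ p ∣P = absN (norm p)

  -- nonzero constants = units of F[t]
  IsUnit : P → Set
  IsUnit p = ∃ λ c → ¬ (c ≡ 0#) × p ≈P const c

  _∣P_ : P → P → Set
  e ∣P p = ∃ λ r → p ≈P e *P r

  -- Binary forms: a list [c₀,…,cₙ] stands for Σ cᵢ x^(n-i) y^i.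

  Form : Set
  Form = List P

  infixl 6 _+F_
  infixl 7 _*F_
  _+F_ : Form → Form → Form
  []      +F g       = g
  (c ∷ f) +F []      = c ∷ f
  (c ∷ f) +F (e ∷ g) = (c +P e) ∷ (f +F g)

  scaleF : P → Form → Form
  scaleF c g = map (c *P_) g

  _*F_ : Form → Form → Form
  []      *F g = []
  (c ∷ f) *F g = scaleF c g +F (0P ∷ (f *F g))

  powForm : Form → ℕ → Form
  powForm l zero    = const 1# ∷ []
  powForm l (suc k) = l *F powForm l k

  substF : Form → Form → Form → Form
  substF f l₁ l₂ = go f 0
    where
    n = length f ∸ 1
    go : Form → ℕ → Form
    go []       i = []
    go (c ∷ cs) i = scaleF c (powForm l₁ (n ∸ i) *F powForm l₂ i) +F go cs (suc i)

  coeffAt : ℕ → Form → P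
  coeffAt i       []      = 0P
  coeffAt zero    (c ∷ f) = c
  coeffAt (suc i) (c ∷ f) = coeffAt i f

  _≈F_ : Form → Form → Set
  f ≈F g = ∀ i → coeffAt i f ≈P coeffAt i g

  Equiv : Form → Form → Set
  Equiv g f = Σ P λ α → Σ P λ β → Σ P λ γ → Σ P λ δ →
    IsUnit (α *P δ -P β *P γ) × (g ≈F substF f (α ∷ β ∷ []) (γ ∷ δ ∷ []))

  record Cubic : Set where
    constructor cubic
    field a b c d : P

  record Quad : Set where
    constructor quad
    field A B C : P

  cubicForm : Cubic → Form
  cubicForm (cubic a b c d) = a ∷ b ∷ c ∷ d ∷ []

  quadForm : Quad → Form
  quadForm (quad A B C) = A ∷ B ∷ C ∷ []

  disc : Cubic → P
  disc (cubic a b c d) =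
    natP 18 *P a *P b *P c *P d +P b *P b *P c *P c
    -P natP 4 *P a *P c *P c *P c -P natP 4 *P b *P b *P b *P d
    -P natP 27 *P a *P a *P d *P d

  neg3D : Cubic → P
  neg3D f = -P (natP 3 *P disc f)

  hessian : Cubic → Quad
  hessian (cubic a b c d) =
    quad (b *P b -P natP 3 *P a *P c) (b *P c -P natP 9 *P a *P d) (c *P c -P natP 3 *P b *P d)

  Primitive : Cubic → Set
  Primitive (cubic a b c d) =
    ∀ e → e ∣P a → e ∣P b → e ∣P c → e ∣P d → IsUnit e

  Irreducible : Cubic → Set
  Irreducible f = ¬ (Σ P λ r → Σ P λ s → Σ Quad λ g →
    cubicForm f ≈F ((r ∷ s ∷ []) *F quadForm g))

-- Reduction theory, relative to the primitive root h and to the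
-- (fixed, otherwise arbitrary) total order _<P_ on F[t] used for
-- "lexicographically smallest".

module Reduction (F : FiniteField) (h : FiniteField.Carrier F)
                 (_<P_ : Rel (List (FiniteField.Carrier F)) 0ℓ) where
  open FiniteField F
  open Poly F

  InS : Carrier → Set
  InS x = ∃ λ i → i ≤ (size ∸ 3) / 2 × x ≡ h ^F i

  Odd : ℕ → Set
  Odd n = ∃ λ k → n ≡ suc (k Data.Nat.+ k)

  Even : ℕ → Set
  Even n = ∃ λ k → n ≡ k Data.Nat.+ k

  ImaginaryΔ : P → Set
  ImaginaryΔ Δ = Odd (deg Δ)

  UnusualΔ : P → Set
  UnusualΔ Δ = Even (deg Δ) × ¬ IsSquare (sgn Δ)

  LexLt : Form → Form → Set
  LexLt []       _        = ⊥
  LexLt (_ ∷ _)  []       = ⊥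
  LexLt (x ∷ xs) (y ∷ ys) = x <P y ⊎ (x ≈P y × LexLt xs ys)

  LexLeq : Form → Form → Set
  LexLeq xs ys = LexLt xs ys ⊎ Pointwise _≈P_ xs ys

  PartiallyReduced : Quad → Set
  PartiallyReduced (quad A B C) =
    ∣ B ∣P < ∣ A ∣P × ∣ A ∣P ≤ ∣ C ∣P
    × (∣ A ∣P < ∣ C ∣P → sgn A ≡ 1# ⊎ sgn A ≡ h)
    × (∣ A ∣P ≡ ∣ C ∣P → sgn A ≡ 1#)
    × (¬ (B ≈P 0P) → InS (sgn B))

  ReducedQ : Quad → Set
  ReducedQ g@(quad A B C) =
    PartiallyReduced g
    × (∣ A ∣P < ∣ C ∣P
       ⊎ (∀ g′ → Equiv (quadForm g′) (quadForm g) → PartiallyReduced g′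
             → LexLeq (quadForm g) (quadForm g′)))

  -- the conditions on a cubic form preceding the lexicographic one
  PreReduced : Cubic → Set
  PreReduced f =
    ReducedQ (hessian f) × InS (sgn (Cubic.a f))
    × (Quad.B (hessian f) ≈P 0P → InS (sgn (Cubic.d f)))

  ReducedCubic : Cubic → Set
  ReducedCubic f =
    PreReduced f
    × (UnusualΔ (neg3D f) →
        ∀ g → Equiv (cubicForm g) (cubicForm f)
            → quadForm (hessian g) ≈F quadForm (hessian f)
            → PreReduced g
            → LexLeq (cubicForm f) (cubicForm g))

module Submission where

open import Defs
open import Level using (0ℓ)
open import Data.Nat using (ℕ; _^_; _≤_)
open import Data.Nat.Primality using (Prime)
open import Data.List using (List)
open import Data.Product using (∃; _×_)
open import Data.Sum using (_⊎_)
open import Relation.Nullary using (¬_)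
open import Relation.Binary using (Rel; IsStrictTotalOrder)
open import Relation.Binary.PropositionalEquality using (_≡_)

open import Data.Nat as ℕ using (zero; suc; _∸_)
import Data.Nat.Properties as ℕ
import Data.Nat.Tactic.RingSolver as ℕ-Solver
open import Data.Nat.Coprimality using (coprime-Bézout; prime⇒coprime)
open import Data.Nat.GCD using (module Bézout)
import Data.Integer as ℤ
import Data.Integer.Properties as ℤ
open import Data.Sign as Sign using (Sign)
open import Data.Maybe using (Maybe; just; nothing)
open import Data.List using ([]; _∷_; map; length)
open import Data.List.Membership.Propositional using (_∈_)
open import Data.List.Relation.Unary.Any using (here)
open import Data.Product using (Σ; _,_; proj₁; proj₂)
open import Data.Sum using (inj₁; inj₂)
import Data.Sum as Sum
open import Data.Empty using (⊥-elim)
open import Function using (_∘_)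
open import Relation.Nullary using (yes; no)
open import Relation.Binary using (tri<; tri≈; tri>)
import Relation.Binary.PropositionalEquality as ≡
open import Algebra.Bundles using (CommutativeRing)
open import Algebra.Structures using (IsCommutativeRing)
import Algebra.Solver.Ring.AlmostCommutativeRing as ACR
import Algebra.Solver.Ring
import Algebra.Properties.Ring
import Algebra.Properties.Semiring.Mult
import Algebra.Properties.CommutativeSemigroup
import Relation.Binary.Reasoning.Setoid as SetoidReasoning

-- Write α, β, γ, δ, π, ρ, n for the degrees of a, b, c, d, P, R, D. Reducedness of the
-- Hessian gives deg Q < π ≤ ρ, so comparing leading terms in Q² − 4PR = −3D yields
-- n = π + ρ. In the syzygy G² + 27Da² = 4P³ (G = 2b³ − 9abc + 27a²d) the leading terms of
-- G² and 27Da² cannot cancel: that would give −3D even degree and a square leading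
-- coefficient, impossible for an imaginary or unusual Hessian. Hence 2α + n ≤ 3π, and so
-- 4α ≤ n. Comparing leading terms in b² = P + 3ac, cP = bQ − 3aR and 9ad = bc − Q then
-- bounds β, β + γ and α + δ by n/4, n/2 and n/2.

-- The coefficient con (+ k) denotes ι k, so goals may mention the ring's own numerals
-- (fromℕ k, natP k) verbatim.
module IntegerCoefficientSolver
    (R : CommutativeRing 0ℓ 0ℓ) (ι : ℕ → CommutativeRing.Carrier R)
    (ι-zero : CommutativeRing._≈_ R (ι 0) (CommutativeRing.0# R))
    (ι-suc : ∀ n → CommutativeRing._≈_ R (ι (suc n)) (CommutativeRing._+_ R (CommutativeRing.1# R) (ι n))) where

  open CommutativeRing R
  open Algebra.Properties.Ring ring using (-0#≈0#; -‿involutive; -‿+-comm; -1*x≈-x)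
  open Algebra.Properties.Semiring.Mult semiring using (×-homo-+; ×1-homo-*) renaming (_×_ to _·_)
  open SetoidReasoning setoid
  open import Data.Integer using (ℤ; +_; -[1+_])

  ι≈×1 : ∀ n → ι n ≈ n · 1#
  ι≈×1 zero    = ι-zero
  ι≈×1 (suc n) = trans (ι-suc n) (+-congˡ (ι≈×1 n))

  ι-+ : ∀ m n → ι (m ℕ.+ n) ≈ ι m + ι n
  ι-+ m n = begin
    ι (m ℕ.+ n)      ≈⟨ ι≈×1 (m ℕ.+ n) ⟩
    (m ℕ.+ n) · 1#   ≈⟨ ×-homo-+ 1# m n ⟩
    m · 1# + n · 1#  ≈⟨ +-cong (ι≈×1 m) (ι≈×1 n) ⟨
    ι m + ι n        ∎

  ι-* : ∀ m n → ι (m ℕ.* n) ≈ ι m * ι n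
  ι-* m n = begin
    ι (m ℕ.* n)          ≈⟨ ι≈×1 (m ℕ.* n) ⟩
    (m ℕ.* n) · 1#       ≈⟨ ×1-homo-* m n ⟩
    (m · 1#) * (n · 1#)  ≈⟨ *-cong (ι≈×1 m) (ι≈×1 n) ⟨
    ι m * ι n            ∎

  fromℤ : ℤ → Carrier
  fromℤ (+ n)    = ι n
  fromℤ -[1+ n ] = - ι (suc n)

  fromℤ-⊖ : ∀ m n → fromℤ (m ℤ.⊖ n) ≈ ι m - ι n
  fromℤ-⊖ m zero = begin
    fromℤ (m ℤ.⊖ 0)  ≡⟨ ≡.cong fromℤ (ℤ.⊖-≥ ℕ.z≤n) ⟩
    ι m              ≈⟨ +-identityʳ (ι m) ⟨
    ι m + 0#         ≈⟨ +-congˡ (trans (-‿cong ι-zero) -0#≈0#) ⟨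
    ι m - ι 0        ∎
  fromℤ-⊖ zero (suc n) = begin
    fromℤ (0 ℤ.⊖ suc n)  ≡⟨ ≡.cong fromℤ (ℤ.⊖-< (ℕ.s≤s ℕ.z≤n)) ⟩
    - ι (suc n)          ≈⟨ +-identityˡ _ ⟨
    0# - ι (suc n)       ≈⟨ +-congʳ ι-zero ⟨
    ι 0 - ι (suc n)      ∎
  fromℤ-⊖ (suc m) (suc n) = begin
    fromℤ (suc m ℤ.⊖ suc n)          ≡⟨ ≡.cong fromℤ (ℤ.[1+m]⊖[1+n]≡m⊖n m n) ⟩
    fromℤ (m ℤ.⊖ n)                  ≈⟨ fromℤ-⊖ m n ⟩
    ι m - ι n                        ≈⟨ +-congʳ (+-identityˡ _) ⟨
    (0# + ι m) - ι n                 ≈⟨ +-congʳ (+-congʳ (-‿inverseʳ 1#)) ⟨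
    ((1# - 1#) + ι m) - ι n          ≈⟨ cancel ⟩
    (1# + ι m) - (1# + ι n)          ≈⟨ +-cong (ι-suc m) (-‿cong (ι-suc n)) ⟨
    ι (suc m) - ι (suc n)            ∎
    where
    cancel : ((1# - 1#) + ι m) - ι n ≈ (1# + ι m) - (1# + ι n)
    cancel = begin
      ((1# - 1#) + ι m) - ι n      ≈⟨ +-congʳ (+-assoc 1# (- 1#) (ι m)) ⟩
      (1# + (- 1# + ι m)) - ι n    ≈⟨ +-congʳ (+-congˡ (+-comm (- 1#) (ι m))) ⟩
      (1# + (ι m - 1#)) - ι n      ≈⟨ +-congʳ (+-assoc 1# (ι m) (- 1#)) ⟨
      ((1# + ι m) - 1#) - ι n      ≈⟨ +-assoc (1# + ι m) (- 1#) (- ι n) ⟩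
      (1# + ι m) + (- 1# - ι n)    ≈⟨ +-congˡ (-‿+-comm 1# (ι n)) ⟩
      (1# + ι m) - (1# + ι n)      ∎

  signValue : Sign → Carrier
  signValue Sign.+ = 1#
  signValue Sign.- = - 1#

  signValue-* : ∀ s t → signValue (s Sign.* t) ≈ signValue s * signValue t
  signValue-* Sign.+ t      = sym (*-identityˡ _)
  signValue-* Sign.- Sign.+ = sym (*-identityʳ _)
  signValue-* Sign.- Sign.- = trans (sym (-‿involutive 1#)) (sym (-1*x≈-x (- 1#)))

  fromℤ-◃ : ∀ s n → fromℤ (s ℤ.◃ n) ≈ signValue s * ι n
  fromℤ-◃ s      zero    = trans ι-zero (trans (sym (zeroʳ _)) (*-congˡ (sym ι-zero)))
  fromℤ-◃ Sign.+ (suc n) = sym (*-identityˡ _)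
  fromℤ-◃ Sign.- (suc n) = sym (-1*x≈-x _)

  fromℤ-sign : ∀ i → fromℤ i ≈ signValue (ℤ.sign i) * ι ℤ.∣ i ∣
  fromℤ-sign (+ n)    = sym (*-identityˡ _)
  fromℤ-sign -[1+ n ] = sym (-1*x≈-x _)

  fromℤ-* : ∀ i j → fromℤ (i ℤ.* j) ≈ fromℤ i * fromℤ j
  fromℤ-* i j = begin
    fromℤ (i ℤ.* j)
      ≈⟨ fromℤ-◃ (s Sign.* t) (ℤ.∣ i ∣ ℕ.* ℤ.∣ j ∣) ⟩
    signValue (s Sign.* t) * ι (ℤ.∣ i ∣ ℕ.* ℤ.∣ j ∣)
      ≈⟨ *-cong (signValue-* s t) (ι-* _ _) ⟩
    (signValue s * signValue t) * (ι ℤ.∣ i ∣ * ι ℤ.∣ j ∣)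
      ≈⟨ interchange _ _ _ _ ⟩
    (signValue s * ι ℤ.∣ i ∣) * (signValue t * ι ℤ.∣ j ∣)
      ≈⟨ *-cong (fromℤ-sign i) (fromℤ-sign j) ⟨
    fromℤ i * fromℤ j ∎
    where
    s = ℤ.sign i
    t = ℤ.sign j
    open Algebra.Properties.CommutativeSemigroup *-commutativeSemigroup using (interchange)

  fromℤ-+ : ∀ i j → fromℤ (i ℤ.+ j) ≈ fromℤ i + fromℤ j
  fromℤ-+ (+ m)    (+ n)    = ι-+ m n
  fromℤ-+ (+ m)    -[1+ n ] = fromℤ-⊖ m (suc n)
  fromℤ-+ -[1+ m ] (+ n)    = trans (fromℤ-⊖ n (suc m)) (+-comm _ _)
  fromℤ-+ -[1+ m ] -[1+ n ] = begin
    - ι (suc (suc (m ℕ.+ n)))    ≡⟨ ≡.cong (λ k → - ι (suc k)) (ℕ.+-suc m n) ⟨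
    - ι (suc m ℕ.+ suc n)        ≈⟨ -‿cong (ι-+ (suc m) (suc n)) ⟩
    - (ι (suc m) + ι (suc n))    ≈⟨ -‿+-comm _ _ ⟨
    - ι (suc m) - ι (suc n)      ∎

  fromℤ-neg : ∀ i → fromℤ (ℤ.- i) ≈ - fromℤ i
  fromℤ-neg (+ zero)  = trans ι-zero (trans (sym -0#≈0#) (-‿cong (sym ι-zero)))
  fromℤ-neg (+ suc n) = refl
  fromℤ-neg -[1+ n ]  = sym (-‿involutive _)

  fromℤ-morphism : ℤ.+-*-rawRing ACR.-Raw-AlmostCommutative⟶ ACR.fromCommutativeRing R
  fromℤ-morphism = record
    { ⟦_⟧    = fromℤ
    ; +-homo = fromℤ-+
    ; *-homo = fromℤ-*
    ; -‿homo = fromℤ-neg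
    ; 0-homo = ι-zero
    ; 1-homo = trans (ι-suc 0) (trans (+-congˡ ι-zero) (+-identityʳ 1#))
    }

  fromℤ-≟ : ∀ i j → Maybe (fromℤ i ≈ fromℤ j)
  fromℤ-≟ i j with i ℤ.≟ j
  ... | yes ≡.refl = just refl
  ... | no _       = nothing

  open Algebra.Solver.Ring ℤ.+-*-rawRing (ACR.fromCommutativeRing R) fromℤ-morphism fromℤ-≟ public

g+g≡n+a+a⇒n-even : ∀ {g a n} → g ℕ.+ g ≡ n ℕ.+ a ℕ.+ a → Σ ℕ λ k → n ≡ k ℕ.+ k
g+g≡n+a+a⇒n-even {g} {a} {n} g+g≡n+a+a = g ∸ a , ℕ.+-cancelʳ-≡ (a ℕ.+ a) n (g ∸ a ℕ.+ (g ∸ a)) (begin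
  n ℕ.+ (a ℕ.+ a)                    ≡⟨ ℕ.+-assoc n a a ⟨
  n ℕ.+ a ℕ.+ a                      ≡⟨ g+g≡n+a+a ⟨
  g ℕ.+ g                            ≡⟨ cong₂ ℕ._+_ g∸a+a≡g g∸a+a≡g ⟨
  (g ∸ a ℕ.+ a) ℕ.+ (g ∸ a ℕ.+ a)    ≡⟨ interchange (g ∸ a) a (g ∸ a) a ⟩
  (g ∸ a ℕ.+ (g ∸ a)) ℕ.+ (a ℕ.+ a)  ∎)
  where
  open ≡ using (sym; trans; cong₂; subst)
  open ≡.≡-Reasoning
  open Algebra.Properties.CommutativeSemigroup ℕ.+-commutativeSemigroup using (interchange)
  a≤g : a ℕ.≤ g
  a≤g = ℕ.≮⇒≥ λ g<a → ℕ.<-irrefl ≡.refl (ℕ.<-≤-trans (ℕ.+-mono-< g<a g<a)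
          (subst (a ℕ.+ a ℕ.≤_) (trans (sym (ℕ.+-assoc n a a)) (sym g+g≡n+a+a)) (ℕ.m≤n+m (a ℕ.+ a) n)))
  g∸a+a≡g : g ∸ a ℕ.+ a ≡ g
  g∸a+a≡g = ℕ.m∸n+n≡m a≤g

module PolynomialRing (F : FiniteField) where
  open FiniteField F
  open Poly F
  open ≡ using (refl; sym; trans; cong; cong₂; module ≡-Reasoning)
  open IsCommutativeRing isCommutativeRing
    using (+-assoc; +-comm; *-comm; *-assoc; +-identityˡ; +-identityʳ; *-identityˡ;
           distribˡ; distribʳ; +-congˡ; +-congʳ; *-congʳ; -‿inverseˡ; -‿inverseʳ; zeroˡ; zeroʳ)

  fieldRing : CommutativeRing 0ℓ 0ℓ
  fieldRing = record { isCommutativeRing = isCommutativeRing }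

  open Algebra.Properties.Ring (CommutativeRing.ring fieldRing) using (-0#≈0#)
  open Algebra.Properties.CommutativeSemigroup (CommutativeRing.+-commutativeSemigroup fieldRing)
    using (x∙yz≈y∙xz; interchange)

  coeff : P → ℕ → Carrier
  coeff []      i       = 0#
  coeff (x ∷ p) zero    = x
  coeff (x ∷ p) (suc i) = coeff p i

  -- Like _≈P_ this ignores trailing zeros, but being coefficientwise it is a congruence for
  -- _+P_ and _*P_ without any reasoning about norm.
  infix 4 _≋_
  record _≋_ (p r : P) : Set where
    constructor coeffwise
    field coeff-≡ : ∀ i → coeff p i ≡ coeff r i
  open _≋_ public

  ≋-refl : ∀ {p} → p ≋ p
  ≋-refl = coeffwise λ _ → refl

  ≋-sym : ∀ {p r} → p ≋ r → r ≋ p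
  ≋-sym e = coeffwise λ i → sym (coeff-≡ e i)

  ≋-trans : ∀ {p r s} → p ≋ r → r ≋ s → p ≋ s
  ≋-trans e f = coeffwise λ i → trans (coeff-≡ e i) (coeff-≡ f i)

  ∷-cong : ∀ {x y p r} → x ≡ y → p ≋ r → x ∷ p ≋ y ∷ r
  ∷-cong x≡y e = coeffwise λ { zero → x≡y ; (suc i) → coeff-≡ e i }

  coeff-+ : ∀ p r i → coeff (p +P r) i ≡ coeff p i + coeff r i
  coeff-+ []      r       i       = sym (+-identityˡ _)
  coeff-+ (x ∷ p) []      i       = sym (+-identityʳ _)
  coeff-+ (x ∷ p) (y ∷ r) zero    = refl
  coeff-+ (x ∷ p) (y ∷ r) (suc i) = coeff-+ p r i

  coeff-neg : ∀ p i → coeff (-P p) i ≡ - coeff p i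
  coeff-neg []      i       = sym -0#≈0#
  coeff-neg (x ∷ p) zero    = refl
  coeff-neg (x ∷ p) (suc i) = coeff-neg p i

  coeff-scale : ∀ a r i → coeff (map (a *_) r) i ≡ a * coeff r i
  coeff-scale a []      i       = sym (zeroʳ a)
  coeff-scale a (x ∷ r) zero    = refl
  coeff-scale a (x ∷ r) (suc i) = coeff-scale a r i

  coeff-*P : ∀ x p r i → coeff ((x ∷ p) *P r) i ≡ x * coeff r i + coeff (0# ∷ p *P r) i
  coeff-*P x p r i = trans (coeff-+ (map (x *_) r) (0# ∷ p *P r) i) (+-congʳ (coeff-scale x r i))

  +P-cong : ∀ {p p′ r r′} → p ≋ p′ → r ≋ r′ → p +P r ≋ p′ +P r′
  +P-cong {p} {p′} {r} {r′} e f = coeffwise λ i → begin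
    coeff (p +P r) i          ≡⟨ coeff-+ p r i ⟩
    coeff p i + coeff r i     ≡⟨ cong₂ _+_ (coeff-≡ e i) (coeff-≡ f i) ⟩
    coeff p′ i + coeff r′ i   ≡⟨ coeff-+ p′ r′ i ⟨
    coeff (p′ +P r′) i        ∎
    where open ≡-Reasoning

  -P-cong : ∀ {p p′} → p ≋ p′ → -P p ≋ -P p′
  -P-cong {p} {p′} e = coeffwise λ i →
    trans (coeff-neg p i) (trans (cong -_ (coeff-≡ e i)) (sym (coeff-neg p′ i)))

  *P-zeroˡ : ∀ p → (∀ i → coeff p i ≡ 0#) → ∀ r i → coeff (p *P r) i ≡ 0#
  *P-zeroˡ []      z r i = refl
  *P-zeroˡ (x ∷ p) z r i = begin
    coeff ((x ∷ p) *P r) i                ≡⟨ coeff-*P x p r i ⟩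
    x * coeff r i + coeff (0# ∷ p *P r) i ≡⟨ cong₂ _+_ (*-congʳ (z 0)) (tail i) ⟩
    0# * coeff r i + 0#                   ≡⟨ trans (+-identityʳ _) (zeroˡ _) ⟩
    0#                                    ∎
    where
    open ≡-Reasoning
    tail : ∀ i → coeff (0# ∷ p *P r) i ≡ 0#
    tail zero    = refl
    tail (suc i) = *P-zeroˡ p (λ j → z (suc j)) r i

  *P-zeroʳ : ∀ r i → coeff (r *P []) i ≡ 0#
  *P-zeroʳ []      i       = refl
  *P-zeroʳ (x ∷ r) zero    = refl
  *P-zeroʳ (x ∷ r) (suc i) = *P-zeroʳ r i

  *P-congʳ : ∀ {p p′} → p ≋ p′ → ∀ r → p *P r ≋ p′ *P r
  *P-congʳ {[]}    {p′}     e r = coeffwise λ i → sym (*P-zeroˡ p′ (λ j → sym (coeff-≡ e j)) r i)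
  *P-congʳ {x ∷ p} {[]}     e r = coeffwise (*P-zeroˡ (x ∷ p) (coeff-≡ e) r)
  *P-congʳ {x ∷ p} {y ∷ p′} e r = coeffwise λ i →
    trans (coeff-*P x p r i)
      (trans (cong₂ _+_ (*-congʳ (coeff-≡ e 0))
                        (coeff-≡ (∷-cong refl (*P-congʳ {p} {p′} (coeffwise λ j → coeff-≡ e (suc j)) r)) i))
             (sym (coeff-*P y p′ r i)))

  *P-congˡ : ∀ p {r r′} → r ≋ r′ → p *P r ≋ p *P r′
  *P-congˡ []      e = ≋-refl
  *P-congˡ (x ∷ p) {r} {r′} e = coeffwise λ i →
    trans (coeff-*P x p r i)
      (trans (cong₂ _+_ (cong (x *_) (coeff-≡ e i)) (coeff-≡ (∷-cong refl (*P-congˡ p e)) i))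
             (sym (coeff-*P x p r′ i)))

  *P-cong : ∀ {p p′ r r′} → p ≋ p′ → r ≋ r′ → p *P r ≋ p′ *P r′
  *P-cong {p′ = p′} {r = r} e f = ≋-trans (*P-congʳ e r) (*P-congˡ p′ f)

  +P-assoc : ∀ p r s → (p +P r) +P s ≋ p +P (r +P s)
  +P-assoc p r s = coeffwise λ i → begin
    coeff ((p +P r) +P s) i                ≡⟨ coeff-+ (p +P r) s i ⟩
    coeff (p +P r) i + coeff s i           ≡⟨ +-congʳ (coeff-+ p r i) ⟩
    (coeff p i + coeff r i) + coeff s i    ≡⟨ +-assoc _ _ _ ⟩
    coeff p i + (coeff r i + coeff s i)    ≡⟨ +-congˡ (coeff-+ r s i) ⟨
    coeff p i + coeff (r +P s) i           ≡⟨ coeff-+ p (r +P s) i ⟨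
    coeff (p +P (r +P s)) i                ∎
    where open ≡-Reasoning

  +P-comm : ∀ p r → p +P r ≋ r +P p
  +P-comm p r = coeffwise λ i → trans (coeff-+ p r i) (trans (+-comm _ _) (sym (coeff-+ r p i)))

  +P-identityʳ : ∀ p → p +P [] ≋ p
  +P-identityʳ p = coeffwise λ i → trans (coeff-+ p [] i) (+-identityʳ _)

  +P-inverseˡ : ∀ p → (-P p) +P p ≋ []
  +P-inverseˡ p = coeffwise λ i →
    trans (coeff-+ (-P p) p i) (trans (+-congʳ (coeff-neg p i)) (-‿inverseˡ _))

  +P-inverseʳ : ∀ p → p +P (-P p) ≋ []
  +P-inverseʳ p = coeffwise λ i →
    trans (coeff-+ p (-P p) i) (trans (+-congˡ (coeff-neg p i)) (-‿inverseʳ _))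

  coeff-∷-+ : ∀ s t i → coeff (0# ∷ s +P t) i ≡ coeff (0# ∷ s) i + coeff (0# ∷ t) i
  coeff-∷-+ s t zero    = sym (+-identityʳ 0#)
  coeff-∷-+ s t (suc i) = coeff-+ s t i

  *P-consʳ : ∀ p y r → p *P (y ∷ r) ≋ map (y *_) p +P (0# ∷ p *P r)
  *P-consʳ []      y r = coeffwise λ { zero → refl ; (suc i) → refl }
  *P-consʳ (x ∷ p) y r = coeffwise λ
    { zero    → trans (coeff-*P x p (y ∷ r) 0) (cong (_+ 0#) (*-comm x y))
    ; (suc i) → begin
        coeff ((x ∷ p) *P (y ∷ r)) (suc i)
          ≡⟨ coeff-*P x p (y ∷ r) (suc i) ⟩
        x * coeff r i + coeff (p *P (y ∷ r)) i
          ≡⟨ +-congˡ (coeff-≡ (*P-consʳ p y r) i) ⟩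
        x * coeff r i + coeff (map (y *_) p +P (0# ∷ p *P r)) i
          ≡⟨ +-congˡ (trans (coeff-+ (map (y *_) p) _ i) (+-congʳ (coeff-scale y p i))) ⟩
        x * coeff r i + (y * coeff p i + coeff (0# ∷ p *P r) i)
          ≡⟨ x∙yz≈y∙xz _ _ _ ⟩
        y * coeff p i + (x * coeff r i + coeff (0# ∷ p *P r) i)
          ≡⟨ cong₂ _+_ (coeff-scale y p i) (coeff-*P x p r i) ⟨
        coeff (map (y *_) p) i + coeff ((x ∷ p) *P r) i
          ≡⟨ coeff-+ (map (y *_) (x ∷ p)) (0# ∷ (x ∷ p) *P r) (suc i) ⟨
        coeff (map (y *_) (x ∷ p) +P (0# ∷ (x ∷ p) *P r)) (suc i) ∎
    }
    where open ≡-Reasoning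

  *P-comm : ∀ p r → p *P r ≋ r *P p
  *P-comm []      r = coeffwise λ i → sym (*P-zeroʳ r i)
  *P-comm (x ∷ p) r = coeffwise λ i → begin
    coeff ((x ∷ p) *P r) i                           ≡⟨ coeff-*P x p r i ⟩
    x * coeff r i + coeff (0# ∷ p *P r) i            ≡⟨ +-congˡ (coeff-≡ (∷-cong refl (*P-comm p r)) i) ⟩
    x * coeff r i + coeff (0# ∷ r *P p) i            ≡⟨ +-congʳ (coeff-scale x r i) ⟨
    coeff (map (x *_) r) i + coeff (0# ∷ r *P p) i   ≡⟨ coeff-+ (map (x *_) r) _ i ⟨
    coeff (map (x *_) r +P (0# ∷ r *P p)) i          ≡⟨ coeff-≡ (*P-consʳ r x p) i ⟨
    coeff (r *P (x ∷ p)) i                           ∎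
    where open ≡-Reasoning

  *P-distribʳ : ∀ p q r → (p +P q) *P r ≋ (p *P r) +P (q *P r)
  *P-distribʳ []      q       r = ≋-refl
  *P-distribʳ (x ∷ p) []      r = ≋-sym (+P-identityʳ _)
  *P-distribʳ (x ∷ p) (y ∷ q) r = coeffwise λ i → begin
    coeff ((x + y ∷ p +P q) *P r) i
      ≡⟨ coeff-*P (x + y) (p +P q) r i ⟩
    (x + y) * coeff r i + coeff (0# ∷ (p +P q) *P r) i
      ≡⟨ +-congˡ (trans (coeff-≡ (∷-cong refl (*P-distribʳ p q r)) i) (coeff-∷-+ (p *P r) (q *P r) i)) ⟩
    (x + y) * coeff r i + (coeff (0# ∷ p *P r) i + coeff (0# ∷ q *P r) i)
      ≡⟨ +-congʳ (distribʳ _ x y) ⟩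
    (x * coeff r i + y * coeff r i) + (coeff (0# ∷ p *P r) i + coeff (0# ∷ q *P r) i)
      ≡⟨ interchange _ _ _ _ ⟩
    (x * coeff r i + coeff (0# ∷ p *P r) i) + (y * coeff r i + coeff (0# ∷ q *P r) i)
      ≡⟨ cong₂ _+_ (coeff-*P x p r i) (coeff-*P y q r i) ⟨
    coeff ((x ∷ p) *P r) i + coeff ((y ∷ q) *P r) i
      ≡⟨ coeff-+ ((x ∷ p) *P r) ((y ∷ q) *P r) i ⟨
    coeff ((x ∷ p) *P r +P (y ∷ q) *P r) i ∎
    where open ≡-Reasoning

  *P-distribˡ : ∀ p q r → p *P (q +P r) ≋ (p *P q) +P (p *P r)
  *P-distribˡ p q r =
    ≋-trans (*P-comm p _) (≋-trans (*P-distribʳ q r p) (+P-cong (*P-comm q p) (*P-comm r p)))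

  *P-scaleˡ : ∀ a q r → map (a *_) q *P r ≋ map (a *_) (q *P r)
  *P-scaleˡ a []      r = ≋-refl
  *P-scaleˡ a (y ∷ q) r = coeffwise λ i → begin
    coeff ((a * y ∷ map (a *_) q) *P r) i
      ≡⟨ coeff-*P (a * y) (map (a *_) q) r i ⟩
    (a * y) * coeff r i + coeff (0# ∷ map (a *_) q *P r) i
      ≡⟨ cong₂ _+_ (*-assoc a y _) (tail i) ⟩
    a * (y * coeff r i) + a * coeff (0# ∷ q *P r) i
      ≡⟨ distribˡ a _ _ ⟨
    a * (y * coeff r i + coeff (0# ∷ q *P r) i)
      ≡⟨ cong (a *_) (coeff-*P y q r i) ⟨
    a * coeff ((y ∷ q) *P r) i
      ≡⟨ coeff-scale a ((y ∷ q) *P r) i ⟨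
    coeff (map (a *_) ((y ∷ q) *P r)) i ∎
    where
    open ≡-Reasoning
    tail : ∀ i → coeff (0# ∷ map (a *_) q *P r) i ≡ a * coeff (0# ∷ q *P r) i
    tail zero    = sym (zeroʳ a)
    tail (suc i) = trans (coeff-≡ (*P-scaleˡ a q r) i) (coeff-scale a (q *P r) i)

  *P-shiftˡ : ∀ s r → (0# ∷ s) *P r ≋ 0# ∷ s *P r
  *P-shiftˡ s r = coeffwise λ i →
    trans (coeff-*P 0# s r i) (trans (+-congʳ (zeroˡ _)) (+-identityˡ _))

  *P-assoc : ∀ p q r → (p *P q) *P r ≋ p *P (q *P r)
  *P-assoc []      q r = ≋-refl
  *P-assoc (x ∷ p) q r =
    ≋-trans (*P-distribʳ (map (x *_) q) (0# ∷ p *P q) r)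
      (+P-cong (*P-scaleˡ x q r) (≋-trans (*P-shiftˡ (p *P q) r) (∷-cong refl (*P-assoc p q r))))

  *P-identityˡ : ∀ r → const 1# *P r ≋ r
  *P-identityˡ r = coeffwise λ i →
    trans (coeff-*P 1# [] r i) (trans (cong₂ _+_ (*-identityˡ _) (empty i)) (+-identityʳ _))
    where
    empty : ∀ i → coeff (0# ∷ []) i ≡ 0#
    empty zero    = refl
    empty (suc i) = refl

  0∷[]≋[] : 0# ∷ [] ≋ []
  0∷[]≋[] = coeffwise λ { zero → refl ; (suc _) → refl }

  polynomialRing : CommutativeRing 0ℓ 0ℓ
  polynomialRing = record
    { Carrier = P ; _≈_ = _≋_ ; _+_ = _+P_ ; _*_ = _*P_ ; -_ = -P_ ; 0# = [] ; 1# = const 1#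
    ; isCommutativeRing = record
      { isRing = record
        { +-isAbelianGroup = record
          { isGroup = record
            { isMonoid = record
              { isSemigroup = record
                { isMagma = record
                  { isEquivalence = record { refl = ≋-refl ; sym = ≋-sym ; trans = ≋-trans }
                  ; ∙-cong = +P-cong }
                ; assoc = +P-assoc }
              ; identity = (λ _ → ≋-refl) , +P-identityʳ }
            ; inverse = +P-inverseˡ , +P-inverseʳ
            ; ⁻¹-cong = -P-cong }
          ; comm = +P-comm }
        ; *-cong = *P-cong
        ; *-assoc = *P-assoc
        ; *-identity = *P-identityˡ , (λ r → ≋-trans (*P-comm r _) (*P-identityˡ r))
        ; distrib = *P-distribˡ , (λ x y z → *P-distribʳ y z x) }
      ; *-comm = *P-comm } }

module LeadingTerms (F : FiniteField) where
  open FiniteField F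
  open Poly F
  open PolynomialRing F
  open ≡ using (refl; sym; trans; cong; cong₂; subst; subst₂; module ≡-Reasoning)
  open IsCommutativeRing isCommutativeRing
    using (*-comm; *-assoc; +-identityˡ; +-identityʳ; *-identityˡ; -‿inverseʳ; zeroˡ; zeroʳ)
  open Algebra.Properties.Ring (CommutativeRing.ring fieldRing) using (-0#≈0#; -‿injective)

  *-≢0 : ∀ {x y} → ¬ x ≡ 0# → ¬ y ≡ 0# → ¬ x * y ≡ 0#
  *-≢0 {x} {y} x≢0 y≢0 xy≡0 with inverse x x≢0
  ... | x⁻¹ , xx⁻¹≡1 = y≢0 (begin
    y               ≡⟨ *-identityˡ y ⟨
    1# * y          ≡⟨ cong (_* y) (trans (sym xx⁻¹≡1) (*-comm x x⁻¹)) ⟩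
    (x⁻¹ * x) * y   ≡⟨ *-assoc x⁻¹ x y ⟩
    x⁻¹ * (x * y)   ≡⟨ cong (x⁻¹ *_) xy≡0 ⟩
    x⁻¹ * 0#        ≡⟨ zeroʳ x⁻¹ ⟩
    0#              ∎)
    where open ≡-Reasoning

  record DegreeBelow (p : P) (m : ℕ) : Set where
    constructor degreeBelow
    field vanishes : ∀ i → m ℕ.≤ i → coeff p i ≡ 0#
  open DegreeBelow public

  record LeadingTerm (p : P) (m : ℕ) (x : Carrier) : Set where
    constructor leadingTerm
    field
      coeff-leading   : coeff p m ≡ x
      leading≢0       : ¬ x ≡ 0#
      degreeBelow-suc : DegreeBelow p (suc m)
  open LeadingTerm public

  degreeBelow-≋ : ∀ {p r m} → p ≋ r → DegreeBelow p m → DegreeBelow r m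
  degreeBelow-≋ e s = degreeBelow λ i m≤i → trans (sym (coeff-≡ e i)) (vanishes s i m≤i)

  leadingTerm-≋ : ∀ {p r m x} → p ≋ r → LeadingTerm p m x → LeadingTerm r m x
  leadingTerm-≋ {m = m} e t =
    leadingTerm (trans (sym (coeff-≡ e m)) (coeff-leading t)) (leading≢0 t) (degreeBelow-≋ e (degreeBelow-suc t))

  degreeBelow-mono : ∀ {p m k} → m ℕ.≤ k → DegreeBelow p m → DegreeBelow p k
  degreeBelow-mono m≤k s = degreeBelow λ i k≤i → vanishes s i (ℕ.≤-trans m≤k k≤i)

  degreeBelow-zero : ∀ {p} → (∀ i → coeff p i ≡ 0#) → ∀ m → DegreeBelow p m
  degreeBelow-zero z m = degreeBelow λ i _ → z i

  leadingTerm-< : ∀ {p m x k} → LeadingTerm p m x → DegreeBelow p k → m ℕ.< k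
  leadingTerm-< {m = m} {k = k} t s with k ℕ.≤? m
  ... | yes k≤m = ⊥-elim (leading≢0 t (trans (sym (coeff-leading t)) (vanishes s m k≤m)))
  ... | no  k≰m = ℕ.≰⇒> k≰m

  leadingTerm-unique : ∀ {p m x n y} → LeadingTerm p m x → LeadingTerm p n y → m ≡ n × x ≡ y
  leadingTerm-unique {p} t u = m≡n , trans (sym (coeff-leading t)) (trans (cong (coeff p) m≡n) (coeff-leading u))
    where
    m≡n = ℕ.≤-antisym (ℕ.≤-pred (leadingTerm-< t (degreeBelow-suc u)))
                      (ℕ.≤-pred (leadingTerm-< u (degreeBelow-suc t)))

  degreeBelow-+ : ∀ {u v k} → DegreeBelow u k → DegreeBelow v k → DegreeBelow (u +P v) k
  degreeBelow-+ {u} {v} su sv = degreeBelow λ i k≤i →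
    trans (coeff-+ u v i) (trans (cong₂ _+_ (vanishes su i k≤i) (vanishes sv i k≤i)) (+-identityʳ 0#))

  degreeBelow-neg : ∀ {u k} → DegreeBelow u k → DegreeBelow (-P u) k
  degreeBelow-neg {u} su = degreeBelow λ i k≤i → trans (coeff-neg u i) (trans (cong -_ (vanishes su i k≤i)) -0#≈0#)

  leadingTerm-+ : ∀ {u v m x} → LeadingTerm u m x → DegreeBelow v m → LeadingTerm (u +P v) m x
  leadingTerm-+ {u} {v} {m} t s = leadingTerm
    (trans (coeff-+ u v m) (trans (cong₂ _+_ (coeff-leading t) (vanishes s m ℕ.≤-refl)) (+-identityʳ _)))
    (leading≢0 t)
    (degreeBelow-+ (degreeBelow-suc t) (degreeBelow-mono (ℕ.n≤1+n m) s))

  leadingTerm-neg : ∀ {u m x} → LeadingTerm u m x → LeadingTerm (-P u) m (- x)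
  leadingTerm-neg {u} {m} {x} t = leadingTerm
    (trans (coeff-neg u m) (cong -_ (coeff-leading t)))
    (λ -x≡0 → leading≢0 t (-‿injective (trans -x≡0 (sym -0#≈0#))))
    (degreeBelow-neg (degreeBelow-suc t))

  leadingTerm-const : ∀ {c} → ¬ c ≡ 0# → LeadingTerm (const c) 0 c
  leadingTerm-const c≢0 = leadingTerm refl c≢0 (degreeBelow λ { zero () ; (suc i) _ → refl })

  degreeBelow-*-zero : ∀ {p} → DegreeBelow p 0 → ∀ r → DegreeBelow (p *P r) 0
  degreeBelow-*-zero {p} s r = degreeBelow λ i _ → *P-zeroˡ p (λ j → vanishes s j ℕ.z≤n) r i

  degreeBelow-∷ : ∀ {a p k} → DegreeBelow p k → DegreeBelow (a ∷ p) (suc k)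
  degreeBelow-∷ s = degreeBelow λ { zero () ; (suc j) (ℕ.s≤s le) → vanishes s j le }

  degreeBelow-∷⁻¹ : ∀ {a p k} → DegreeBelow (a ∷ p) (suc k) → DegreeBelow p k
  degreeBelow-∷⁻¹ s = degreeBelow λ j le → vanishes s (suc j) (ℕ.s≤s le)

  leadingTerm-∷ : ∀ {a p m x} → LeadingTerm p m x → LeadingTerm (a ∷ p) (suc m) x
  leadingTerm-∷ t = leadingTerm (coeff-leading t) (leading≢0 t) (degreeBelow-∷ (degreeBelow-suc t))

  leadingTerm-∷⁻¹ : ∀ {a p m x} → LeadingTerm (a ∷ p) (suc m) x → LeadingTerm p m x
  leadingTerm-∷⁻¹ t = leadingTerm (coeff-leading t) (leading≢0 t) (degreeBelow-∷⁻¹ (degreeBelow-suc t))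

  degreeBelow-scale : ∀ {c r k} → DegreeBelow r k → DegreeBelow (map (c *_) r) k
  degreeBelow-scale {c} {r} s = degreeBelow λ i k≤i →
    trans (coeff-scale c r i) (trans (cong (c *_) (vanishes s i k≤i)) (zeroʳ c))

  leadingTerm-scale : ∀ {c r n y} → ¬ c ≡ 0# → LeadingTerm r n y → LeadingTerm (map (c *_) r) n (c * y)
  leadingTerm-scale {c} {r} {n} c≢0 t = leadingTerm
    (trans (coeff-scale c r n) (cong (c *_) (coeff-leading t)))
    (*-≢0 c≢0 (leading≢0 t))
    (degreeBelow-scale (degreeBelow-suc t))

  degreeBelow-* : ∀ {p k r n} → DegreeBelow p k → DegreeBelow r (suc n) → DegreeBelow (p *P r) (k ℕ.+ n)
  degreeBelow-* {[]}              sp sr = degreeBelow λ _ _ → refl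
  degreeBelow-* {z ∷ p} {zero}    sp sr = degreeBelow-mono ℕ.z≤n (degreeBelow-*-zero sp _)
  degreeBelow-* {z ∷ p} {suc k} {n = n} sp sr =
    degreeBelow-+ (degreeBelow-mono (ℕ.s≤s (ℕ.m≤n+m n k)) (degreeBelow-scale sr))
                  (degreeBelow-∷ (degreeBelow-* (degreeBelow-∷⁻¹ sp) sr))

  leadingTerm-* : ∀ {p m x r n y} → LeadingTerm p m x → LeadingTerm r n y → LeadingTerm (p *P r) (m ℕ.+ n) (x * y)
  leadingTerm-* {[]} t u = ⊥-elim (leading≢0 t (sym (coeff-leading t)))
  leadingTerm-* {z ∷ p} {zero} {r = r} {n} {y} t u =
    subst (λ x → LeadingTerm ((z ∷ p) *P r) n (x * y)) (coeff-leading t)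
      (leadingTerm-+ (leadingTerm-scale (λ z≡0 → leading≢0 t (trans (sym (coeff-leading t)) z≡0)) u)
                     (degreeBelow-zero shifted-zero n))
    where
    shifted-zero : ∀ i → coeff (0# ∷ p *P r) i ≡ 0#
    shifted-zero zero    = refl
    shifted-zero (suc i) = *P-zeroˡ p (λ j → vanishes (degreeBelow-suc t) (suc j) (ℕ.s≤s ℕ.z≤n)) r i
  leadingTerm-* {z ∷ p} {suc m} {r = r} {n} t u =
    leadingTerm-≋ (+P-comm (0# ∷ p *P r) (map (z *_) r))
      (leadingTerm-+ (leadingTerm-∷ (leadingTerm-* (leadingTerm-∷⁻¹ t) u))
                     (degreeBelow-mono (ℕ.s≤s (ℕ.m≤n+m n m)) (degreeBelow-scale (degreeBelow-suc u))))

  data Normal : P → Set where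
    empty : Normal []
    last  : ∀ {a} → ¬ a ≡ 0# → Normal (a ∷ [])
    cons  : ∀ a {b r} → Normal (b ∷ r) → Normal (a ∷ b ∷ r)

  normal-norm : ∀ p → Normal (norm p)
  normal-norm []      = empty
  normal-norm (a ∷ p) with norm p | normal-norm p
  ... | []    | _ with a ≟ 0#
  ...   | yes _   = empty
  ...   | no  a≢0 = last a≢0
  normal-norm (a ∷ p) | b ∷ r | n = cons a n

  norm-≋ : ∀ p → norm p ≋ p
  norm-≋ []      = ≋-refl
  norm-≋ (a ∷ p) with norm p | norm-≋ p
  ... | []    | []≋p with a ≟ 0#
  ...   | yes a≡0 = ≋-trans (≋-sym 0∷[]≋[]) (∷-cong (sym a≡0) []≋p)
  ...   | no  _   = ∷-cong refl []≋p
  norm-≋ (a ∷ p) | b ∷ r | b∷r≋p = ∷-cong refl b∷r≋p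

  norm≡⇒≋ : ∀ {p l} → norm p ≡ l → l ≋ p
  norm≡⇒≋ {p} refl = norm-≋ p

  norm-normal : ∀ {l} → Normal l → norm l ≡ l
  norm-normal empty            = refl
  norm-normal (last {a} a≢0) with a ≟ 0#
  ... | yes a≡0 = ⊥-elim (a≢0 a≡0)
  ... | no  _   = refl
  norm-normal (cons a n) rewrite norm-normal n = refl

  sgn-normal : ∀ {p x r} → Normal (x ∷ r) → norm p ≡ x ∷ r → sgn p ≡ coeff (x ∷ r) (length r)
  sgn-normal {p} (last _) eq with norm p
  sgn-normal {p} (last _) refl | _ = refl
  sgn-normal {p} {x} (cons _ {b} {r} n) eq
    with norm p | eq | norm (b ∷ r) | norm-normal n | sgn-normal {b ∷ r} n (norm-normal n)
  ... | _ | refl | _ | refl | ih = ih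

  leadingTerm-normal : ∀ {x r} → Normal (x ∷ r) → LeadingTerm (x ∷ r) (length r) (coeff (x ∷ r) (length r))
  leadingTerm-normal (last x≢0) = leadingTerm-const x≢0
  leadingTerm-normal (cons x n) = leadingTerm-∷ (leadingTerm-normal n)

  data Shape (p : P) : Set where
    zeroPoly : norm p ≡ [] → Shape p
    nonzero  : ∀ m x → LeadingTerm p m x → Shape p

  leadingTerm-via-norm : ∀ {p x r} → norm p ≡ x ∷ r → Normal (x ∷ r) →
                         LeadingTerm p (length r) (coeff (x ∷ r) (length r))
  leadingTerm-via-norm eq n =
    leadingTerm-≋ (norm≡⇒≋ eq) (leadingTerm-normal n)

  shape : ∀ p → Shape p
  shape p with norm p in eq | normal-norm p
  ... | []    | _ = zeroPoly eq
  ... | x ∷ r | n = nonzero _ _ (leadingTerm-via-norm eq n)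

  norm≡[]⇒degreeBelow : ∀ {p} → norm p ≡ [] → ∀ m → DegreeBelow p m
  norm≡[]⇒degreeBelow {p} eq = degreeBelow-≋ (norm≡⇒≋ eq) ∘ degreeBelow-zero (λ _ → refl)

  norm≡[]⇒∣∣≡0 : ∀ {p} → norm p ≡ [] → ∣ p ∣P ≡ 0
  norm≡[]⇒∣∣≡0 {p} eq rewrite eq = refl

  norm≡[]⇒sgn≡0 : ∀ {p} → norm p ≡ [] → sgn p ≡ 0#
  norm≡[]⇒sgn≡0 {p} eq rewrite eq = refl

  leadingTerm-norm : ∀ {p m x} → LeadingTerm p m x → Σ Carrier λ y → Σ P λ r →
    norm p ≡ y ∷ r × Normal (y ∷ r) × length r ≡ m × coeff (y ∷ r) (length r) ≡ x
  leadingTerm-norm {p} t with norm p in eq | normal-norm p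
  ... | []    | _ = ⊥-elim (ℕ.n≮0 (leadingTerm-< t (norm≡[]⇒degreeBelow eq 0)))
  ... | y ∷ r | n with leadingTerm-unique t (leadingTerm-via-norm eq n)
  ...   | m≡ , x≡ = y , r , refl , n , sym m≡ , sym x≡

  leadingTerm-∣∣ : ∀ {p m x} → LeadingTerm p m x → ∣ p ∣P ≡ size ^ m
  leadingTerm-∣∣ {p} t with leadingTerm-norm t
  ... | _ , _ , eq , _ , refl , _ rewrite eq = refl

  leadingTerm-deg : ∀ {p m x} → LeadingTerm p m x → deg p ≡ m
  leadingTerm-deg {p} t with leadingTerm-norm t
  ... | _ , _ , eq , _ , refl , _ rewrite eq = refl

  leadingTerm-sgn : ∀ {p m x} → LeadingTerm p m x → sgn p ≡ x
  leadingTerm-sgn {p} t with leadingTerm-norm t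
  ... | _ , _ , eq , n , _ , c≡x = trans (sgn-normal {p} n eq) c≡x

  leadingTerm-sum : ∀ {X Y Z m x j k} → DegreeBelow Y j → DegreeBelow Z k →
                    LeadingTerm X m x → X ≋ Y +P Z → m ℕ.< j ⊎ m ℕ.< k
  leadingTerm-sum {m = m} {j = j} {k} sY sZ t X≋Y+Z with m ℕ.<? j | m ℕ.<? k
  ... | yes m<j | _       = inj₁ m<j
  ... | no  _   | yes m<k = inj₂ m<k
  ... | no  m≮j | no m≮k  = ⊥-elim (ℕ.<-irrefl refl (leadingTerm-< t
          (degreeBelow-≋ (≋-sym X≋Y+Z) (degreeBelow-+ (degreeBelow-mono (ℕ.≮⇒≥ m≮j) sY)
                                                    (degreeBelow-mono (ℕ.≮⇒≥ m≮k) sZ)))))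

  leadingTerm-*⁻¹ : ∀ {p r m x} → LeadingTerm (p *P r) m x →
    Σ ℕ λ j → Σ ℕ λ k → Σ Carrier λ y → Σ Carrier λ z →
      LeadingTerm p j y × LeadingTerm r k z × m ≡ j ℕ.+ k
  leadingTerm-*⁻¹ {p} {r} t with shape p | shape r
  ... | zeroPoly eq | _ =
    ⊥-elim (ℕ.n≮0 (leadingTerm-< t (degreeBelow-*-zero (norm≡[]⇒degreeBelow {p} eq 0) r)))
  ... | nonzero _ _ _ | zeroPoly eq =
    ⊥-elim (ℕ.n≮0 (leadingTerm-< t
      (degreeBelow-≋ (*P-comm r p) (degreeBelow-*-zero (norm≡[]⇒degreeBelow {r} eq 0) p))))
  ... | nonzero j y tp | nonzero k z tr =
    j , k , y , z , tp , tr , proj₁ (leadingTerm-unique t (leadingTerm-* tp tr))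

  cancelling-leadingTerm : ∀ {G Y m y} → LeadingTerm Y m y → DegreeBelow (G *P G +P Y) m →
    Σ ℕ λ g → Σ Carrier λ c → LeadingTerm G g c × g ℕ.+ g ≡ m × c * c + y ≡ 0#
  cancelling-leadingTerm {G} {Y} {m} {y} tY s with shape G
  ... | zeroPoly eq = ⊥-elim (ℕ.<-irrefl refl (leadingTerm-< (leadingTerm-≋ (+P-comm Y (G *P G))
          (leadingTerm-+ tY (degreeBelow-mono ℕ.z≤n (degreeBelow-*-zero (norm≡[]⇒degreeBelow {G} eq 0) G)))) s))
  ... | nonzero g c tG with ℕ.<-cmp (g ℕ.+ g) m
  ...   | tri< g+g<m _ _ = ⊥-elim (ℕ.<-irrefl refl (leadingTerm-< (leadingTerm-≋ (+P-comm Y (G *P G))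
          (leadingTerm-+ tY (degreeBelow-mono g+g<m (degreeBelow-suc (leadingTerm-* tG tG))))) s))
  ...   | tri> _ _ g+g>m = ⊥-elim (ℕ.<-irrefl refl (ℕ.<-trans g+g>m (leadingTerm-<
          (leadingTerm-+ (leadingTerm-* tG tG) (degreeBelow-mono g+g>m (degreeBelow-suc tY))) s)))
  ...   | tri≈ _ g+g≡m _ = g , c , tG , g+g≡m , (begin
      c * c + y                            ≡⟨ cong₂ _+_ (coeff-leading tG²) (coeff-leading tY) ⟨
      coeff (G *P G) m + coeff Y m         ≡⟨ coeff-+ (G *P G) Y m ⟨
      coeff (G *P G +P Y) m                ≡⟨ vanishes s m ℕ.≤-refl ⟩
      0#                                   ∎)
    where
    open ≡-Reasoning
    tG² : LeadingTerm (G *P G) m (c * c)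
    tG² = subst (λ k → LeadingTerm (G *P G) k (c * c)) g+g≡m (leadingTerm-* tG tG)

  1<size : 1 ℕ.< size
  1<size = twoDistinct (elements-complete 0#) (elements-complete 1#) 0≢1
    where
    twoDistinct : ∀ {xs : List Carrier} {x y} → x ∈ xs → y ∈ xs → ¬ x ≡ y → 1 ℕ.< length xs
    twoDistinct {_ ∷ []}    (here refl) (here refl) x≢y = ⊥-elim (x≢y refl)
    twoDistinct {_ ∷ _ ∷ _} _           _           _   = ℕ.s≤s (ℕ.s≤s ℕ.z≤n)

  instance
    size-nonZero : ℕ.NonZero size
    size-nonZero = ℕ.>-nonZero (ℕ.<-trans ℕ.z<s 1<size)

  ∣∣<⇒degreeBelow : ∀ {p m} → ∣ p ∣P ℕ.< size ^ m → DegreeBelow p m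
  ∣∣<⇒degreeBelow {p} {m} ∣p∣<qᵐ with shape p
  ... | zeroPoly eq  = norm≡[]⇒degreeBelow {p} eq m
  ... | nonzero k _ t = degreeBelow-mono k<m (degreeBelow-suc t)
    where
    k<m : k ℕ.< m
    k<m with m ℕ.≤? k
    ... | no  m≰k = ℕ.≰⇒> m≰k
    ... | yes m≤k = ⊥-elim (ℕ.<-irrefl refl (ℕ.≤-<-trans (ℕ.^-monoʳ-≤ size m≤k)
                                              (subst (ℕ._< size ^ m) (leadingTerm-∣∣ t) ∣p∣<qᵐ)))

  ∣∣-≤⇒≤ : ∀ {p r m k x y} → LeadingTerm p m x → LeadingTerm r k y → ∣ p ∣P ℕ.≤ ∣ r ∣P → m ℕ.≤ k
  ∣∣-≤⇒≤ {m = m} {k} tp tr ∣p∣≤∣r∣ with m ℕ.≤? k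
  ... | yes m≤k = m≤k
  ... | no  m≰k = ⊥-elim (ℕ.<-irrefl refl (ℕ.≤-<-trans
          (subst₂ ℕ._≤_ (leadingTerm-∣∣ tp) (leadingTerm-∣∣ tr) ∣p∣≤∣r∣) (ℕ.^-monoʳ-< size 1<size (ℕ.≰⇒> m≰k))))

  ∣∣^≤ : ∀ {X D n y} e → LeadingTerm D n y → (∀ {m x} → LeadingTerm X m x → suc e ℕ.* m ℕ.≤ n) →
         ∣ X ∣P ^ suc e ℕ.≤ ∣ D ∣P
  ∣∣^≤ {X} {n = n} e tD bound with shape X
  ... | zeroPoly eq   rewrite norm≡[]⇒∣∣≡0 {X} eq = ℕ.z≤n
  ... | nonzero m x t rewrite leadingTerm-∣∣ t | leadingTerm-∣∣ tD | ℕ.^-*-assoc size m (suc e) =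
    ℕ.^-monoʳ-≤ size (subst (ℕ._≤ n) (ℕ.*-comm (suc e) m) (bound t))

  HasSquareLeadingTerm : P → Set
  HasSquareLeadingTerm p = Σ ℕ λ k → Σ Carrier λ y → LeadingTerm p (k ℕ.+ k) (y * y)

  LeadingTermOf : P → Set
  LeadingTermOf p = Σ ℕ λ m → Σ Carrier λ x → LeadingTerm p m x

  nonzero⇒leadingTerm : ∀ {p} → ¬ norm p ≡ [] → LeadingTermOf p
  nonzero⇒leadingTerm {p} p≢0 with shape p
  ... | zeroPoly eq   = ⊥-elim (p≢0 eq)
  ... | nonzero m x t = m , x , t

  ∣∣≢0⇒leadingTerm : ∀ {p} → ¬ ∣ p ∣P ≡ 0 → LeadingTermOf p
  ∣∣≢0⇒leadingTerm {p} ∣p∣≢0 = nonzero⇒leadingTerm λ eq → ∣p∣≢0 (norm≡[]⇒∣∣≡0 {p} eq)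

  sgn≢0⇒leadingTerm : ∀ {p} → ¬ sgn p ≡ 0# → LeadingTermOf p
  sgn≢0⇒leadingTerm {p} sgn≢0 = nonzero⇒leadingTerm λ eq → sgn≢0 (norm≡[]⇒sgn≡0 {p} eq)

module FieldArithmetic (F : FiniteField) where
  open FiniteField F
  open PolynomialRing F using (fieldRing)
  open LeadingTerms F using (*-≢0)
  open ≡ using (refl; sym; trans; cong; cong₂; subst; module ≡-Reasoning)
  open IsCommutativeRing isCommutativeRing
    using (+-identityˡ; +-identityʳ; *-identityˡ; *-identityʳ; *-congˡ; zeroˡ; zeroʳ)
  open Algebra.Properties.Ring (CommutativeRing.ring fieldRing) using (+-cancelˡ)
  open IntegerCoefficientSolver fieldRing fromℕ refl (λ _ → refl)
    using (ι-*; solve; _:=_; _:+_; _:*_; :-_; con)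

  fromℕ-*-≡0 : ∀ m n → fromℕ n ≡ 0# → fromℕ (m ℕ.* n) ≡ 0#
  fromℕ-*-≡0 m n n≡0 = trans (ι-* m n) (trans (cong (fromℕ m *_) n≡0) (zeroʳ _))

  fromℕ-suc-≢0 : ∀ {s} → fromℕ s ≡ 0# → ¬ fromℕ (suc s) ≡ 0#
  fromℕ-suc-≢0 {s} s≡0 s+1≡0 = 0≢1 (begin
    0#             ≡⟨ s+1≡0 ⟨
    1# + fromℕ s   ≡⟨ cong (1# +_) s≡0 ⟩
    1# + 0#        ≡⟨ +-identityʳ 1# ⟩
    1#             ∎)
    where open ≡-Reasoning

  fromℕ-prime : ∀ {p r} → Prime p → fromℕ p ≡ 0# → 0 ℕ.< r → r ℕ.< p → ¬ fromℕ r ≡ 0#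
  fromℕ-prime {p} {suc r} p-prime p≡0 _ r<p r≡0
    with coprime-Bézout (prime⇒coprime p-prime r<p)
  ... | Bézout.+- x y eq = fromℕ-suc-≢0 {y ℕ.* suc r} (fromℕ-*-≡0 y (suc r) r≡0)
                             (subst (λ t → fromℕ t ≡ 0#) (sym eq) (fromℕ-*-≡0 x p p≡0))
  ... | Bézout.-+ x y eq = fromℕ-suc-≢0 {x ℕ.* p} (fromℕ-*-≡0 x p p≡0)
                             (subst (λ t → fromℕ t ≡ 0#) (sym eq) (fromℕ-*-≡0 y (suc r) r≡0))

  ^F-≢0 : ∀ {h} → ¬ h ≡ 0# → ∀ i → ¬ h ^F i ≡ 0#
  ^F-≢0 h≢0 zero    1≡0   = 0≢1 (sym 1≡0)
  ^F-≢0 h≢0 (suc i)       = *-≢0 h≢0 (^F-≢0 h≢0 i)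

  primitiveRoot-≢0 : ∀ {h x} → IsPrimitiveRoot h → ¬ x ≡ 0# → ¬ x ≡ 1# → ¬ h ≡ 0#
  primitiveRoot-≢0 {h} {x} h-primitive x≢0 x≢1 refl with h-primitive x x≢0
  ... | zero  , x≡1 = x≢1 x≡1
  ... | suc i , x≡0 = x≢0 (trans x≡0 (zeroˡ _))

  2≢1 : ¬ fromℕ 2 ≡ 1#
  2≢1 2≡1 = fromℕ-suc-≢0 {0} refl (+-cancelˡ 1# (fromℕ 1) 0# (trans 2≡1 (sym (+-identityʳ 1#))))

  -- c² = −27·u·v² = −3u·(3v)², so −3u is the square of c/(3v).
  square-after-cancellation : ∀ c w u v → c * c + fromℕ 27 * u * v * v ≡ 0# →
                              fromℕ 3 * v * w ≡ 1# → (c * w) * (c * w) ≡ - (fromℕ 3 * u)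
  square-after-cancellation c w u v cancel 3v·w≡1 = begin
    (c * w) * (c * w)
      ≡⟨ solve 4 (λ c w u v → (c :* w) :* (c :* w) :=
           (c :* c :+ con (ℤ.+ 27) :* u :* v :* v) :* (w :* w)
           :+ (:- (con (ℤ.+ 3) :* u)) :* ((con (ℤ.+ 3) :* v :* w) :* (con (ℤ.+ 3) :* v :* w))) refl c w u v ⟩
    (c * c + fromℕ 27 * u * v * v) * (w * w) + (- (fromℕ 3 * u)) * ((fromℕ 3 * v * w) * (fromℕ 3 * v * w))
      ≡⟨ cong₂ (λ s t → s * (w * w) + (- (fromℕ 3 * u)) * (t * t)) cancel 3v·w≡1 ⟩
    0# * (w * w) + (- (fromℕ 3 * u)) * (1# * 1#)
      ≡⟨ cong₂ _+_ (zeroˡ _) (trans (*-congˡ (*-identityˡ 1#)) (*-identityʳ _)) ⟩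
    0# + - (fromℕ 3 * u)
      ≡⟨ +-identityˡ _ ⟩
    - (fromℕ 3 * u) ∎
    where open ≡-Reasoning

module CubicInvariants (F : FiniteField) (a b c d : Poly.P F) where
  open FiniteField F
  open Poly F
  open PolynomialRing F
  open IntegerCoefficientSolver polynomialRing natP 0∷[]≋[] (λ _ → ≋-refl)
    using (solve; _:=_; _:+_; _:*_; _:-_; :-_; con)

  f : Cubic
  f = cubic a b c d

  Pₕ Qₕ Rₕ D G : P
  Pₕ = Quad.A (hessian f)
  Qₕ = Quad.B (hessian f)
  Rₕ = Quad.C (hessian f)
  D  = disc f
  G  = natP 2 *P b *P b *P b -P natP 9 *P a *P b *P c +P natP 27 *P a *P a *P d

  hessian-discriminant : Qₕ *P Qₕ -P natP 4 *P Pₕ *P Rₕ ≋ neg3D f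
  hessian-discriminant = solve 4 (λ a b c d →
    let P = b :* b :- con (ℤ.+ 3) :* a :* c
        Q = b :* c :- con (ℤ.+ 9) :* a :* d
        R = c :* c :- con (ℤ.+ 3) :* b :* d
        D = con (ℤ.+ 18) :* a :* b :* c :* d :+ b :* b :* c :* c :- con (ℤ.+ 4) :* a :* c :* c :* c
            :- con (ℤ.+ 4) :* b :* b :* b :* d :- con (ℤ.+ 27) :* a :* a :* d :* d
    in Q :* Q :- con (ℤ.+ 4) :* P :* R := :- (con (ℤ.+ 3) :* D)) ≋-refl a b c d

  syzygy : G *P G +P natP 27 *P D *P a *P a ≋ natP 4 *P Pₕ *P Pₕ *P Pₕ
  syzygy = solve 4 (λ a b c d →
    let G = con (ℤ.+ 2) :* b :* b :* b :- con (ℤ.+ 9) :* a :* b :* c :+ con (ℤ.+ 27) :* a :* a :* d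
        P = b :* b :- con (ℤ.+ 3) :* a :* c
        D = con (ℤ.+ 18) :* a :* b :* c :* d :+ b :* b :* c :* c :- con (ℤ.+ 4) :* a :* c :* c :* c
            :- con (ℤ.+ 4) :* b :* b :* b :* d :- con (ℤ.+ 27) :* a :* a :* d :* d
    in G :* G :+ con (ℤ.+ 27) :* D :* a :* a := con (ℤ.+ 4) :* P :* P :* P) ≋-refl a b c d

  b²≋Pₕ+3ac : b *P b ≋ Pₕ +P natP 3 *P a *P c
  b²≋Pₕ+3ac = solve 3 (λ a b c →
    b :* b := (b :* b :- con (ℤ.+ 3) :* a :* c) :+ con (ℤ.+ 3) :* a :* c) ≋-refl a b c

  cPₕ≋bQₕ-3aRₕ : c *P Pₕ ≋ b *P Qₕ -P natP 3 *P a *P Rₕ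
  cPₕ≋bQₕ-3aRₕ = solve 4 (λ a b c d →
    c :* (b :* b :- con (ℤ.+ 3) :* a :* c)
      := b :* (b :* c :- con (ℤ.+ 9) :* a :* d)
         :- con (ℤ.+ 3) :* a :* (c :* c :- con (ℤ.+ 3) :* b :* d)) ≋-refl a b c d

  9ad≋bc-Qₕ : natP 9 *P a *P d ≋ b *P c -P Qₕ
  9ad≋bc-Qₕ = solve 4 (λ a b c d →
    con (ℤ.+ 9) :* a :* d := b :* c :- (b :* c :- con (ℤ.+ 9) :* a :* d)) ≋-refl a b c d

module DegreeBounds (F : FiniteField) where
  open FiniteField F
  open Poly F
  open PolynomialRing F
  open LeadingTerms F
  open FieldArithmetic F
  open ≡ using (refl; sym; trans; cong; subst; subst₂)
  open IntegerCoefficientSolver fieldRing fromℕ refl (λ _ → refl) using (ι-*)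
  open ℕ.≤-Reasoning

  module _ (2≢0 : ¬ fromℕ 2 ≡ 0#) (3≢0 : ¬ fromℕ 3 ≡ 0#) (a b c d : P) where
    open CubicInvariants F a b c d

    4≢0 : ¬ fromℕ 4 ≡ 0#
    4≢0 4≡0 = *-≢0 2≢0 2≢0 (trans (sym (ι-* 2 2)) 4≡0)

    9≢0 : ¬ fromℕ 9 ≡ 0#
    9≢0 9≡0 = *-≢0 3≢0 3≢0 (trans (sym (ι-* 3 3)) 9≡0)

    27≢0 : ¬ fromℕ 27 ≡ 0#
    27≢0 27≡0 = *-≢0 3≢0 9≢0 (trans (sym (ι-* 3 9)) 27≡0)

    module _ {α n π ρ : ℕ} {la lD lP lR : Carrier}
        (a-lead : LeadingTerm a α la) (D-lead : LeadingTerm D n lD) (Pₕ-lead : LeadingTerm Pₕ π lP)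
        (Qₕ-deg : DegreeBelow Qₕ π) (Rₕ-lead : LeadingTerm Rₕ ρ lR) (π≤ρ : π ℕ.≤ ρ)
        (no-square : ¬ HasSquareLeadingTerm (neg3D f)) where

      -3D-lead : LeadingTerm (neg3D f) n (- (fromℕ 3 * lD))
      -3D-lead = leadingTerm-neg (leadingTerm-* (leadingTerm-const 3≢0) D-lead)

      n≡π+ρ : n ≡ π ℕ.+ ρ
      n≡π+ρ = sym (proj₁ (leadingTerm-unique -3D-lead′ -3D-lead))
        where
        Qₕ²-deg : DegreeBelow (Qₕ *P Qₕ) (π ℕ.+ ρ)
        Qₕ²-deg = degreeBelow-* Qₕ-deg (degreeBelow-mono (ℕ.≤-trans π≤ρ (ℕ.n≤1+n ρ)) Qₕ-deg)
        -3D-lead′ : LeadingTerm (neg3D f) (π ℕ.+ ρ) (- (fromℕ 4 * lP * lR))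
        -3D-lead′ = leadingTerm-≋ (≋-trans (+P-comm (-P (natP 4 *P Pₕ *P Rₕ)) (Qₕ *P Qₕ)) hessian-discriminant)
          (leadingTerm-+ (leadingTerm-neg (leadingTerm-* (leadingTerm-* (leadingTerm-const 4≢0) Pₕ-lead) Rₕ-lead))
                         Qₕ²-deg)

      2π≤n : 2 ℕ.* π ℕ.≤ n
      2π≤n = begin
        2 ℕ.* π   ≡⟨ ℕ-Solver.solve (π ∷ []) ⟩
        π ℕ.+ π   ≤⟨ ℕ.+-monoʳ-≤ π π≤ρ ⟩
        π ℕ.+ ρ   ≡⟨ n≡π+ρ ⟨
        n         ∎

      27Da²-lead : LeadingTerm (natP 27 *P D *P a *P a) (n ℕ.+ α ℕ.+ α) (fromℕ 27 * lD * la * la)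
      27Da²-lead = leadingTerm-* (leadingTerm-* (leadingTerm-* (leadingTerm-const 27≢0) D-lead) a-lead) a-lead

      4Pₕ³-lead : LeadingTerm (natP 4 *P Pₕ *P Pₕ *P Pₕ) (π ℕ.+ π ℕ.+ π) (fromℕ 4 * lP * lP * lP)
      4Pₕ³-lead = leadingTerm-* (leadingTerm-* (leadingTerm-* (leadingTerm-const 4≢0) Pₕ-lead) Pₕ-lead) Pₕ-lead

      4Pₕ³-degreeBelow : 3 ℕ.* π ℕ.< 2 ℕ.* α ℕ.+ n → DegreeBelow (natP 4 *P Pₕ *P Pₕ *P Pₕ) (n ℕ.+ α ℕ.+ α)
      4Pₕ³-degreeBelow 3π<2α+n = degreeBelow-mono (begin
        suc (π ℕ.+ π ℕ.+ π)   ≡⟨ cong suc (ℕ-Solver.solve (π ∷ [])) ⟩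
        suc (3 ℕ.* π)         ≤⟨ 3π<2α+n ⟩
        2 ℕ.* α ℕ.+ n         ≡⟨ ℕ-Solver.solve (α ∷ n ∷ []) ⟩
        n ℕ.+ α ℕ.+ α         ∎)
        (degreeBelow-suc 4Pₕ³-lead)

      square-leadingTerm : 3 ℕ.* π ℕ.< 2 ℕ.* α ℕ.+ n → HasSquareLeadingTerm (neg3D f)
      square-leadingTerm 3π<2α+n =
        square (cancelling-leadingTerm {G} 27Da²-lead (degreeBelow-≋ (≋-sym syzygy) (4Pₕ³-degreeBelow 3π<2α+n)))
        where
        square : (Σ ℕ λ g → Σ Carrier λ c → LeadingTerm G g c
                   × g ℕ.+ g ≡ n ℕ.+ α ℕ.+ α × c * c + fromℕ 27 * lD * la * la ≡ 0#)
               → HasSquareLeadingTerm (neg3D f)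
        square (g , lg , _ , g+g≡n+α+α , cancel) =
          let w , 3la·w≡1 = inverse (fromℕ 3 * la) (*-≢0 3≢0 (leading≢0 a-lead))
              k , n≡k+k   = g+g≡n+a+a⇒n-even {g} g+g≡n+α+α
          in k , lg * w , subst₂ (LeadingTerm (neg3D f)) n≡k+k
                            (sym (square-after-cancellation lg w lD la cancel 3la·w≡1)) -3D-lead

      syzygy-bound : 2 ℕ.* α ℕ.+ n ℕ.≤ 3 ℕ.* π
      syzygy-bound = ℕ.≮⇒≥ λ 3π<2α+n → no-square (square-leadingTerm 3π<2α+n)

      4α≤n : 4 ℕ.* α ℕ.≤ n
      4α≤n = ℕ.+-cancelʳ-≤ (2 ℕ.* n) (4 ℕ.* α) n (begin
        4 ℕ.* α ℕ.+ 2 ℕ.* n     ≡⟨ ℕ-Solver.solve (α ∷ n ∷ []) ⟩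
        2 ℕ.* (2 ℕ.* α ℕ.+ n)   ≤⟨ ℕ.*-monoʳ-≤ 2 syzygy-bound ⟩
        2 ℕ.* (3 ℕ.* π)         ≡⟨ ℕ-Solver.solve (π ∷ []) ⟩
        3 ℕ.* (2 ℕ.* π)         ≤⟨ ℕ.*-monoʳ-≤ 3 2π≤n ⟩
        3 ℕ.* n                 ≡⟨ ℕ-Solver.solve (n ∷ []) ⟩
        n ℕ.+ 2 ℕ.* n           ∎)

      2α+ρ≤2π : 2 ℕ.* α ℕ.+ ρ ℕ.≤ 2 ℕ.* π
      2α+ρ≤2π = ℕ.+-cancelʳ-≤ π (2 ℕ.* α ℕ.+ ρ) (2 ℕ.* π) (begin
        2 ℕ.* α ℕ.+ ρ ℕ.+ π     ≡⟨ ℕ-Solver.solve (α ∷ ρ ∷ π ∷ []) ⟩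
        2 ℕ.* α ℕ.+ (π ℕ.+ ρ)   ≡⟨ cong (2 ℕ.* α ℕ.+_) n≡π+ρ ⟨
        2 ℕ.* α ℕ.+ n           ≤⟨ syzygy-bound ⟩
        3 ℕ.* π                 ≡⟨ ℕ-Solver.solve (π ∷ []) ⟩
        2 ℕ.* π ℕ.+ π           ∎)

      module _ {β lb} (b-lead : LeadingTerm b β lb) where

        b²-split : ∀ {γ lc} → LeadingTerm c γ lc → β ℕ.+ β ℕ.≤ π ⊎ β ℕ.+ β ℕ.≤ α ℕ.+ γ
        b²-split c-lead = Sum.map ℕ.≤-pred ℕ.≤-pred
          (leadingTerm-sum (degreeBelow-suc Pₕ-lead)
             (degreeBelow-suc (leadingTerm-* (leadingTerm-* (leadingTerm-const 3≢0) a-lead) c-lead))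
             (leadingTerm-* b-lead b-lead) b²≋Pₕ+3ac)

        cPₕ-split : ∀ {γ lc} → LeadingTerm c γ lc → γ ℕ.≤ β ⊎ γ ℕ.+ π ℕ.≤ α ℕ.+ ρ
        cPₕ-split {γ} c-lead = Sum.map γ≤β ℕ.≤-pred
          (leadingTerm-sum (degreeBelow-≋ (*P-comm Qₕ b) (degreeBelow-* Qₕ-deg (degreeBelow-suc b-lead)))
             (degreeBelow-neg (degreeBelow-suc
                (leadingTerm-* (leadingTerm-* (leadingTerm-const 3≢0) a-lead) Rₕ-lead)))
             (leadingTerm-* c-lead Pₕ-lead) cPₕ≋bQₕ-3aRₕ)
          where
          γ≤β : γ ℕ.+ π ℕ.< π ℕ.+ β → γ ℕ.≤ β
          γ≤β lt = ℕ.<⇒≤ (ℕ.+-cancelˡ-< π γ β (subst (ℕ._< π ℕ.+ β) (ℕ.+-comm γ π) lt))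

        2β≤π : ∀ {γ lc} → LeadingTerm c γ lc → γ ℕ.+ π ℕ.≤ α ℕ.+ ρ → β ℕ.+ β ℕ.≤ π
        2β≤π {γ} c-lead γ+π≤α+ρ with b²-split c-lead
        ... | inj₁ 2β≤π   = 2β≤π
        ... | inj₂ 2β≤α+γ = ℕ.+-cancelʳ-≤ π (β ℕ.+ β) π (begin
          β ℕ.+ β ℕ.+ π          ≤⟨ ℕ.+-monoˡ-≤ π 2β≤α+γ ⟩
          α ℕ.+ γ ℕ.+ π          ≡⟨ ℕ.+-assoc α γ π ⟩
          α ℕ.+ (γ ℕ.+ π)        ≤⟨ ℕ.+-monoʳ-≤ α γ+π≤α+ρ ⟩
          α ℕ.+ (α ℕ.+ ρ)        ≡⟨ ℕ-Solver.solve (α ∷ ρ ∷ []) ⟩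
          2 ℕ.* α ℕ.+ ρ          ≤⟨ 2α+ρ≤2π ⟩
          2 ℕ.* π                ≡⟨ ℕ-Solver.solve (π ∷ []) ⟩
          π ℕ.+ π                ∎)

        2β≤π⇒4β≤n : β ℕ.+ β ℕ.≤ π → 4 ℕ.* β ℕ.≤ n
        2β≤π⇒4β≤n 2β≤π = begin
          4 ℕ.* β              ≡⟨ ℕ-Solver.solve (β ∷ []) ⟩
          2 ℕ.* (β ℕ.+ β)      ≤⟨ ℕ.*-monoʳ-≤ 2 2β≤π ⟩
          2 ℕ.* π              ≤⟨ 2π≤n ⟩
          n                    ∎

        4β≤n-lead : ∀ {γ lc} → LeadingTerm c γ lc → 4 ℕ.* β ℕ.≤ n
        4β≤n-lead {γ} c-lead = Sum.[ γ≤β⇒4β≤n , (λ h → 2β≤π⇒4β≤n (2β≤π c-lead h)) ]′ (cPₕ-split c-lead)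
          where
          γ≤β⇒4β≤n : γ ℕ.≤ β → 4 ℕ.* β ℕ.≤ n
          γ≤β⇒4β≤n γ≤β = Sum.[ 2β≤π⇒4β≤n , (λ 2β≤α+γ → ℕ.≤-trans (ℕ.*-monoʳ-≤ 4
                            (ℕ.+-cancelʳ-≤ β β α (ℕ.≤-trans 2β≤α+γ (ℕ.+-monoʳ-≤ α γ≤β)))) 4α≤n) ]′
                            (b²-split c-lead)

        4β≤n : 4 ℕ.* β ℕ.≤ n
        4β≤n = by-shape (shape c)
          where
          by-shape : Shape c → 4 ℕ.* β ℕ.≤ n
          by-shape (nonzero _ _ c-lead) = 4β≤n-lead c-lead
          by-shape (zeroPoly eq)        = Sum.[ (λ 2β<1+π → 2β≤π⇒4β≤n (ℕ.≤-pred 2β<1+π)) , (λ ()) ]′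
            (leadingTerm-sum (degreeBelow-suc Pₕ-lead)
               (degreeBelow-≋ (*P-comm c (natP 3 *P a))
                  (degreeBelow-*-zero (norm≡[]⇒degreeBelow {c} eq 0) (natP 3 *P a)))
               (leadingTerm-* b-lead b-lead) b²≋Pₕ+3ac)

        2[β+γ]≤n : ∀ {γ lc} → LeadingTerm c γ lc → 2 ℕ.* (β ℕ.+ γ) ℕ.≤ n
        2[β+γ]≤n {γ} c-lead = Sum.[ γ≤β⇒2[β+γ]≤n , γ+π≤α+ρ⇒2[β+γ]≤n ]′ (cPₕ-split c-lead)
          where
          γ≤β⇒2[β+γ]≤n : γ ℕ.≤ β → 2 ℕ.* (β ℕ.+ γ) ℕ.≤ n
          γ≤β⇒2[β+γ]≤n γ≤β = begin
            2 ℕ.* (β ℕ.+ γ)   ≤⟨ ℕ.*-monoʳ-≤ 2 (ℕ.+-monoʳ-≤ β γ≤β) ⟩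
            2 ℕ.* (β ℕ.+ β)   ≡⟨ ℕ-Solver.solve (β ∷ []) ⟩
            4 ℕ.* β           ≤⟨ 4β≤n-lead c-lead ⟩
            n                 ∎
          γ+π≤α+ρ⇒2[β+γ]≤n : γ ℕ.+ π ℕ.≤ α ℕ.+ ρ → 2 ℕ.* (β ℕ.+ γ) ℕ.≤ n
          γ+π≤α+ρ⇒2[β+γ]≤n γ+π≤α+ρ = ℕ.+-cancelʳ-≤ (2 ℕ.* π) (2 ℕ.* (β ℕ.+ γ)) n (begin
            2 ℕ.* (β ℕ.+ γ) ℕ.+ 2 ℕ.* π     ≡⟨ ℕ-Solver.solve (β ∷ γ ∷ π ∷ []) ⟩
            (β ℕ.+ β) ℕ.+ 2 ℕ.* (γ ℕ.+ π)   ≤⟨ ℕ.+-mono-≤ (2β≤π c-lead γ+π≤α+ρ) (ℕ.*-monoʳ-≤ 2 γ+π≤α+ρ) ⟩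
            π ℕ.+ 2 ℕ.* (α ℕ.+ ρ)           ≡⟨ ℕ-Solver.solve (π ∷ α ∷ ρ ∷ []) ⟩
            (π ℕ.+ ρ) ℕ.+ (2 ℕ.* α ℕ.+ ρ)   ≤⟨ ℕ.+-mono-≤ (ℕ.≤-reflexive (sym n≡π+ρ)) 2α+ρ≤2π ⟩
            n ℕ.+ 2 ℕ.* π                   ∎)

      2m≤n-of-bc : ∀ {m x} → LeadingTerm (b *P c) m x → 2 ℕ.* m ℕ.≤ n
      2m≤n-of-bc bc-lead with leadingTerm-*⁻¹ {b} {c} bc-lead
      ... | _ , _ , _ , _ , b-lead , c-lead , refl = 2[β+γ]≤n b-lead c-lead

      module _ {δ ld} (d-lead : LeadingTerm d δ ld) where

        9ad-lead : LeadingTerm (natP 9 *P a *P d) (α ℕ.+ δ) (fromℕ 9 * la * ld)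
        9ad-lead = leadingTerm-* (leadingTerm-* (leadingTerm-const 9≢0) a-lead) d-lead

        α+δ<π⇒2[α+δ]≤n : α ℕ.+ δ ℕ.< π → 2 ℕ.* (α ℕ.+ δ) ℕ.≤ n
        α+δ<π⇒2[α+δ]≤n α+δ<π = ℕ.≤-trans (ℕ.*-monoʳ-≤ 2 (ℕ.<⇒≤ α+δ<π)) 2π≤n

        2[α+δ]≤n : 2 ℕ.* (α ℕ.+ δ) ℕ.≤ n
        2[α+δ]≤n = by-shape (shape (b *P c))
          where
          by-shape : Shape (b *P c) → 2 ℕ.* (α ℕ.+ δ) ℕ.≤ n
          by-shape (zeroPoly eq) = Sum.[ (λ ()) , α+δ<π⇒2[α+δ]≤n ]′
            (leadingTerm-sum (norm≡[]⇒degreeBelow {b *P c} eq 0) (degreeBelow-neg Qₕ-deg) 9ad-lead 9ad≋bc-Qₕ)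
          by-shape (nonzero _ _ bc-lead) =
            Sum.[ (λ lt → ℕ.≤-trans (ℕ.*-monoʳ-≤ 2 (ℕ.≤-pred lt)) (2m≤n-of-bc bc-lead)) , α+δ<π⇒2[α+δ]≤n ]′
            (leadingTerm-sum (degreeBelow-suc bc-lead) (degreeBelow-neg Qₕ-deg) 9ad-lead 9ad≋bc-Qₕ)

      4m≤n-of-a : ∀ {m x} → LeadingTerm a m x → 4 ℕ.* m ℕ.≤ n
      4m≤n-of-a a-lead′ = subst (λ m → 4 ℕ.* m ℕ.≤ n) (proj₁ (leadingTerm-unique a-lead a-lead′)) 4α≤n

      2m≤n-of-ad : ∀ {m x} → LeadingTerm (a *P d) m x → 2 ℕ.* m ℕ.≤ n
      2m≤n-of-ad ad-lead with leadingTerm-*⁻¹ {a} {d} ad-lead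
      ... | _ , _ , _ , _ , a-lead′ , d-lead , refl
        rewrite sym (proj₁ (leadingTerm-unique a-lead a-lead′)) = 2[α+δ]≤n d-lead

      absolute-bounds : (∣ a ∣P ^ 4 ℕ.≤ ∣ D ∣P) × (∣ b ∣P ^ 4 ℕ.≤ ∣ D ∣P)
                        × (∣ b *P c ∣P ^ 2 ℕ.≤ ∣ D ∣P) × (∣ a *P d ∣P ^ 2 ℕ.≤ ∣ D ∣P)
      absolute-bounds = ∣∣^≤ 3 D-lead 4m≤n-of-a , ∣∣^≤ 3 D-lead 4β≤n
                      , ∣∣^≤ 1 D-lead 2m≤n-of-bc , ∣∣^≤ 1 D-lead 2m≤n-of-ad

module _ (F : FiniteField) (h : FiniteField.Carrier F) (_<P_ : Rel (List (FiniteField.Carrier F)) 0ℓ) where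
  open FiniteField F
  open Poly F
  open Reduction F h _<P_
  open LeadingTerms F

  imaginary-or-unusual⇒¬square : ∀ {Δ} → ImaginaryΔ Δ ⊎ UnusualΔ Δ → ¬ HasSquareLeadingTerm Δ
  imaginary-or-unusual⇒¬square {Δ} (inj₁ (j , deg≡1+2j)) (k , y , t) =
    ℕ.even≢odd k j (begin
      2 ℕ.* k               ≡⟨ ℕ-Solver.solve (k ∷ []) ⟩
      k ℕ.+ k               ≡⟨ leadingTerm-deg t ⟨
      deg Δ                 ≡⟨ deg≡1+2j ⟩
      suc (j ℕ.+ j)         ≡⟨ ℕ-Solver.solve (j ∷ []) ⟩
      suc (2 ℕ.* j)         ∎)
    where open ≡.≡-Reasoning
  imaginary-or-unusual⇒¬square (inj₂ (_ , sgn-nonsquare)) (k , y , t) =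
    sgn-nonsquare (y , ≡.sym (leadingTerm-sgn t))

theorem5p3 : (F : FiniteField) (p : ℕ) → Prime p → 5 ≤ p
  → FiniteField.fromℕ F p ≡ FiniteField.0# F
  → (∃ λ k → FiniteField.size F ≡ p ^ k)
  → (h : FiniteField.Carrier F) → FiniteField.IsPrimitiveRoot F h
  → (_<P_ : Rel (List (FiniteField.Carrier F)) 0ℓ)
  → IsStrictTotalOrder (Poly._≈P_ F) _<P_
  → (f : Poly.Cubic F)
  → let open FiniteField F
        open Poly F
        open Reduction F h _<P_
        D = disc f
        a = Cubic.a f
        b = Cubic.b f
        c = Cubic.c f
        d = Cubic.d f
    in Primitive f → Irreducible f → ¬ (D ≈P 0P)
       → (sgn (neg3D f) ≡ 1# ⊎ sgn (neg3D f) ≡ h)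
       → (ImaginaryΔ (neg3D f) ⊎ UnusualΔ (neg3D f))
       → ReducedCubic f
       → (∣ a ∣P ^ 4 ≤ ∣ D ∣P) × (∣ b ∣P ^ 4 ≤ ∣ D ∣P)
         × (∣ b *P c ∣P ^ 2 ≤ ∣ D ∣P) × (∣ a *P d ∣P ^ 2 ≤ ∣ D ∣P)
theorem5p3 F p p-prime 5≤p p≡0 _ h h-primitive _<P_ _ f _ _ D≉0 _ imaginary-or-unusual
  ((((∣Qₕ∣<∣Pₕ∣ , ∣Pₕ∣≤∣Rₕ∣ , _) , _) , (i , _ , sgn-a≡hⁱ) , _) , _) =
  DegreeBounds.absolute-bounds F 2≢0 3≢0 (Cubic.a f) (Cubic.b f) (Cubic.c f) (Cubic.d f)
    (lead a-lead) (lead D-lead) (lead Pₕ-lead) Qₕ-deg (lead Rₕ-lead)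
    (∣∣-≤⇒≤ (lead Pₕ-lead) (lead Rₕ-lead) ∣Pₕ∣≤∣Rₕ∣)
    (imaginary-or-unusual⇒¬square F h _<P_ imaginary-or-unusual)
  where
  open FiniteField F
  open Poly F
  open LeadingTerms F
  open FieldArithmetic F
  open CubicInvariants F (Cubic.a f) (Cubic.b f) (Cubic.c f) (Cubic.d f) using (Pₕ; Qₕ; Rₕ)

  lead : ∀ {X} (t : LeadingTermOf X) → LeadingTerm X (proj₁ t) (proj₁ (proj₂ t))
  lead t = proj₂ (proj₂ t)

  fromℕ≢0 : ∀ r → 0 ℕ.< r → r ℕ.< 5 → ¬ fromℕ r ≡ 0#
  fromℕ≢0 r 0<r r<5 = fromℕ-prime p-prime p≡0 0<r (ℕ.<-≤-trans r<5 5≤p)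

  2≢0 : ¬ fromℕ 2 ≡ 0#
  2≢0 = fromℕ≢0 2 ℕ.z<s (ℕ.s≤s (ℕ.s≤s (ℕ.s≤s ℕ.z≤n)))

  3≢0 : ¬ fromℕ 3 ≡ 0#
  3≢0 = fromℕ≢0 3 ℕ.z<s (ℕ.s≤s (ℕ.s≤s (ℕ.s≤s (ℕ.s≤s ℕ.z≤n))))

  a-lead : LeadingTermOf (Cubic.a f)
  a-lead = sgn≢0⇒leadingTerm λ sgn-a≡0 →
    ^F-≢0 (primitiveRoot-≢0 h-primitive 2≢0 2≢1) i (≡.trans (≡.sym sgn-a≡hⁱ) sgn-a≡0)

  D-lead : LeadingTermOf (disc f)
  D-lead = nonzero⇒leadingTerm D≉0

  Pₕ-lead : LeadingTermOf Pₕ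
  Pₕ-lead = ∣∣≢0⇒leadingTerm (ℕ.m<n⇒n≢0 ∣Qₕ∣<∣Pₕ∣)

  Rₕ-lead : LeadingTermOf Rₕ
  Rₕ-lead = ∣∣≢0⇒leadingTerm (ℕ.m<n⇒n≢0 (ℕ.<-≤-trans ∣Qₕ∣<∣Pₕ∣ ∣Pₕ∣≤∣Rₕ∣))

  Qₕ-deg : DegreeBelow Qₕ (proj₁ Pₕ-lead)
  Qₕ-deg = ∣∣<⇒degreeBelow (≡.subst (∣ Qₕ ∣P ℕ.<_) (leadingTerm-∣∣ (lead Pₕ-lead)) ∣Qₕ∣<∣Pₕ∣)
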